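{- For every positive integer $n$, $$\gcd(f_n, f_{n+1}-1)=\begin{cases}2, & \text{if } n\equiv 3\pmod 6,\\ 1, & \text{if } n\equiv 1,5\pmod 6,\\ f_{n/2}, & \text{if } n\equiv 0\pmod 4,\\ f_{n/2}+2f_{n/2-1}, & \text{if } n\equiv 2\pmod 4.\end{cases}$$
   Context: $(f_n)$ denotes the Fibonacci sequence, $f_0=0$, $f_1=1$, $f_{n+1}=f_n+f_{n-1}$. -}

module Defs where

open import Data.Nat using (ℕ; zero; suc; _+_)

fib : ℕ → ℕ
fib zero = 0
fib (suc zero) = 1
fib (suc (suc n)) = fib (suc n) + fib n

{-# OPTIONS --safe #-}
-- For n = 2m the doubling formula f₂ₘ = fₘ Lₘ (L the Lucas numbers) and Cassini's identity give
-- f₂ₘ₊₁ − 1 = fₘ Lₘ₊₁ when m is even and f₂ₘ₊₁ − 1 = Lₘ fₘ₊₁ when m is odd. The two numbers thus share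
-- the factor fₘ, resp. Lₘ = fₘ + 2fₘ₋₁, and what remains is coprime, since consecutive Fibonacci and
-- consecutive Lucas numbers are. For odd n Cassini reads fₙ₊₁² + 1 = fₙ₊₂ fₙ, so a common divisor of
-- fₙ and fₙ₊₁ − 1 divides fₙ₊₁² + 1 − (fₙ₊₁² − 1) = 2; it is 2 exactly when fₙ is even and fₙ₊₁ odd,
-- and fₖ is even exactly when 3 ∣ k.
module Submission where

open import Defs
open import Data.Nat using (ℕ; zero; suc; _+_; _*_; _∸_; _/_; _%_; _≥_; NonZero)
open import Data.Nat.Properties using (+-suc; +-comm; +-identityʳ; *-comm; *-assoc; *-identityʳ; m+n∸n≡m)
open import Data.Nat.DivMod using (m≡m%n+[m/n]*n; [m+kn]%n≡m%n; m*n%n≡0; %-distribˡ-+; m*n/n≡m; m∣n⇒o%n%m≡o%m)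
open import Data.Nat.Divisibility
open import Data.Nat.GCD using (gcd; gcd[m,n]∣m; gcd[m,n]∣n; gcd-greatest; c*gcd[m,n]≡gcd[cm,cn])
open import Data.Nat.Coprimality using (Coprime; coprime-+; coprime⇒gcd≡1)
import Data.Nat.Coprimality as Coprime
open import Data.Nat.Tactic.RingSolver using (solve-∀)
open import Data.Product using (_×_; _,_)
open import Data.Sum using (_⊎_; inj₁; inj₂)
open import Relation.Binary.PropositionalEquality
open ≡-Reasoning

fib-+ : ∀ m n → fib (suc (m + n)) ≡ fib (suc m) * fib (suc n) + fib m * fib n
fib-+ zero n = units (fib (suc n)) (fib n)
  where
  units : ∀ x y → x ≡ 1 * x + 0 * y
  units = solve-∀
fib-+ (suc m) n = begin
  fib (suc (suc m + n))                                       ≡⟨ cong fib (sym (+-suc (suc m) n)) ⟩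
  fib (suc (m + suc n))                                       ≡⟨ fib-+ m (suc n) ⟩
  fib (suc m) * (fib (suc n) + fib n) + fib m * fib (suc n)   ≡⟨ regroup (fib (suc m)) (fib m) (fib (suc n)) (fib n) ⟩
  (fib (suc m) + fib m) * fib (suc n) + fib (suc m) * fib n   ∎
  where
  regroup : ∀ a b c d → a * (c + d) + b * c ≡ (a + b) * c + a * d
  regroup = solve-∀

lucas : ℕ → ℕ
lucas zero = 2
lucas (suc zero) = 1
lucas (suc (suc n)) = lucas (suc n) + lucas n

lucas-suc : ∀ n → lucas (suc n) ≡ fib (suc (suc n)) + fib n
lucas-suc zero = refl
lucas-suc (suc zero) = refl
lucas-suc (suc (suc n)) = trans (cong₂ _+_ (lucas-suc (suc n)) (lucas-suc n))
                                (interchange (fib (3 + n)) (fib (suc n)) (fib (2 + n)) (fib n))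
  where
  interchange : ∀ a b c d → (a + b) + (c + d) ≡ (a + c) + (b + d)
  interchange = solve-∀

fib-double : ∀ m → fib (m * 2) ≡ fib m * lucas m
fib-double zero = refl
fib-double (suc m) = begin
  fib (suc (suc (m * 2)))                                       ≡⟨ cong (λ k → fib (suc k)) (double m) ⟩
  fib (suc (m + suc m))                                         ≡⟨ fib-+ m (suc m) ⟩
  fib (suc m) * fib (suc (suc m)) + fib m * fib (suc m)         ≡⟨ factor (fib (suc m)) (fib (suc (suc m))) (fib m) ⟩
  fib (suc m) * (fib (suc (suc m)) + fib m)                     ≡⟨ cong (fib (suc m) *_) (sym (lucas-suc m)) ⟩
  fib (suc m) * lucas (suc m)                                   ∎
  where
  double : ∀ m → suc (m * 2) ≡ m + suc m
  double = solve-∀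
  factor : ∀ a b c → a * b + c * a ≡ a * (b + c)
  factor = solve-∀

fib-suc-double : ∀ m → fib (suc (m * 2)) ≡ fib (suc m) * fib (suc m) + fib m * fib m
fib-suc-double m = trans (cong (λ k → fib (suc k)) (double m)) (fib-+ m m)
  where
  double : ∀ m → m * 2 ≡ m + m
  double = solve-∀

%-cong-suc : ∀ {m n} d .{{_ : NonZero d}} → m % d ≡ n % d → suc m % d ≡ suc n % d
%-cong-suc {m} {n} d h = begin
  (1 + m) % d             ≡⟨ %-distribˡ-+ 1 m d ⟩
  (1 % d + m % d) % d     ≡⟨ cong (λ r → (1 % d + r) % d) h ⟩
  (1 % d + n % d) % d     ≡⟨ %-distribˡ-+ 1 n d ⟨
  (1 + n) % d             ∎

-- Cassini's identity fib (n + 1)² − fib (n + 2) fib n = (−1)ⁿ, with the sign term moved to the side where it is added.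
cassini : ∀ n → fib (suc n) * fib (suc n) + n % 2 ≡ fib (suc (suc n)) * fib n + suc n % 2
cassini zero = refl
cassini (suc n) = step (fib n) (fib (suc n)) (cassini n)
  where
  step : ∀ a b {x y} → b * b + x ≡ (b + a) * a + y → (b + a) * (b + a) + y ≡ ((b + a) + b) * b + x
  step a b {x} {y} h = begin
    (b + a) * (b + a) + y             ≡⟨ split a b y ⟩
    ((b + a) * a + y) + (b + a) * b   ≡⟨ cong (_+ (b + a) * b) h ⟨
    (b * b + x) + (b + a) * b         ≡⟨ merge a b x ⟩
    ((b + a) + b) * b + x             ∎
    where
    split : ∀ a b y → (b + a) * (b + a) + y ≡ ((b + a) * a + y) + (b + a) * b
    split = solve-∀
    merge : ∀ a b x → (b * b + x) + (b + a) * b ≡ ((b + a) + b) * b + x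
    merge = solve-∀

cassini-even : ∀ n → n % 2 ≡ 0 → fib (suc n) * fib (suc n) ≡ fib (suc (suc n)) * fib n + 1
cassini-even n h = trans (sym (+-identityʳ _))
  (subst₂ (λ x y → fib (suc n) * fib (suc n) + x ≡ fib (suc (suc n)) * fib n + y) h (%-cong-suc {n} {0} 2 h) (cassini n))

cassini-odd : ∀ n → n % 2 ≡ 1 → fib (suc n) * fib (suc n) + 1 ≡ fib (suc (suc n)) * fib n
cassini-odd n h = trans
  (subst₂ (λ x y → fib (suc n) * fib (suc n) + x ≡ fib (suc (suc n)) * fib n + y) h (%-cong-suc {n} {1} 2 h) (cassini n))
  (+-identityʳ _)

fib-suc-double-even : ∀ m → m % 2 ≡ 0 → fib (suc (m * 2)) ≡ fib m * lucas (suc m) + 1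
fib-suc-double-even m h = begin
  fib (suc (m * 2))                                           ≡⟨ fib-suc-double m ⟩
  fib (suc m) * fib (suc m) + fib m * fib m                   ≡⟨ cong (_+ fib m * fib m) (cassini-even m h) ⟩
  fib (suc (suc m)) * fib m + 1 + fib m * fib m               ≡⟨ factor (fib (suc (suc m))) (fib m) ⟩
  fib m * (fib (suc (suc m)) + fib m) + 1                     ≡⟨ cong (λ l → fib m * l + 1) (lucas-suc m) ⟨
  fib m * lucas (suc m) + 1                                   ∎
  where
  factor : ∀ a b → a * b + 1 + b * b ≡ b * (a + b) + 1
  factor = solve-∀

fib-suc-double-odd : ∀ m → m % 2 ≡ 0 → fib (suc (suc m * 2)) ≡ lucas (suc m) * fib (suc (suc m)) + 1
fib-suc-double-odd m h = begin
  fib (suc (suc m * 2))                                                     ≡⟨ fib-suc-double (suc m) ⟩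
  fib (suc (suc m)) * fib (suc (suc m)) + fib (suc m) * fib (suc m)         ≡⟨ cong (fib (suc (suc m)) * fib (suc (suc m)) +_)
                                                                                    (cassini-even m h) ⟩
  fib (suc (suc m)) * fib (suc (suc m)) + (fib (suc (suc m)) * fib m + 1)   ≡⟨ factor (fib (suc (suc m))) (fib m) ⟩
  (fib (suc (suc m)) + fib m) * fib (suc (suc m)) + 1                       ≡⟨ cong (λ l → l * fib (suc (suc m)) + 1) (lucas-suc m) ⟨
  lucas (suc m) * fib (suc (suc m)) + 1                                     ∎
  where
  factor : ∀ a b → a * a + (a * b + 1) ≡ (a + b) * a + 1
  factor = solve-∀

coprime-consecutive : (s : ℕ → ℕ) → (∀ n → s (suc (suc n)) ≡ s (suc n) + s n) →
                      Coprime (s 0) (s 1) → ∀ n → Coprime (s n) (s (suc n))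
coprime-consecutive s rec c zero = c
coprime-consecutive s rec c (suc n) =
  subst (Coprime (s (suc n))) (sym (rec n)) (Coprime.sym (coprime-+ (coprime-consecutive s rec c n)))

fib-coprime-suc : ∀ n → Coprime (fib n) (fib (suc n))
fib-coprime-suc = coprime-consecutive fib (λ _ → refl) (Coprime.sym (Coprime.1-coprimeTo 0))

lucas-coprime-suc : ∀ n → Coprime (lucas n) (lucas (suc n))
lucas-coprime-suc = coprime-consecutive lucas (λ _ → refl) (Coprime.sym (Coprime.1-coprimeTo 2))

gcd[cm,cn]≡c : ∀ c {m n} → Coprime m n → gcd (c * m) (c * n) ≡ c
gcd[cm,cn]≡c c {m} {n} coprime = begin
  gcd (c * m) (c * n)   ≡⟨ c*gcd[m,n]≡gcd[cm,cn] c m n ⟨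
  c * gcd m n           ≡⟨ cong (c *_) (coprime⇒gcd≡1 coprime) ⟩
  c * 1                 ≡⟨ *-identityʳ c ⟩
  c                     ∎

fib-3+-%2 : ∀ n → fib (3 + n) % 2 ≡ fib n % 2
fib-3+-%2 n = trans (cong (_% 2) (regroup (fib (suc n)) (fib n))) ([m+kn]%n≡m%n (fib n) (fib (suc n)) 2)
  where
  regroup : ∀ a b → (a + b) + a ≡ b + a * 2
  regroup = solve-∀

fib-%2-period : ∀ k r → fib (k * 3 + r) % 2 ≡ fib r % 2
fib-%2-period zero    r = refl
fib-%2-period (suc k) r = trans (fib-3+-%2 (k * 3 + r)) (fib-%2-period k r)

fib-%2 : ∀ n {r} → n % 3 ≡ r → fib n % 2 ≡ fib r % 2
fib-%2 n {r} h = begin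
  fib n % 2                   ≡⟨ cong (λ m → fib m % 2) (trans (m≡m%n+[m/n]*n n 3) (+-comm (n % 3) _)) ⟩
  fib (n / 3 * 3 + n % 3) % 2 ≡⟨ fib-%2-period (n / 3) (n % 3) ⟩
  fib (n % 3) % 2             ≡⟨ cong (λ m → fib m % 2) h ⟩
  fib r % 2                   ∎

%-reduce : ∀ m {d} n {r} .{{_ : NonZero m}} .{{_ : NonZero d}} → m ∣ d → n % d ≡ r → n % m ≡ r % m
%-reduce m {d} n m∣d h = trans (sym (m∣n⇒o%n%m≡o%m m d n m∣d)) (cong (_% m) h)

residue-elim : (P : ℕ → Set) (m r : ℕ) .{{_ : NonZero m}} → (∀ q → P (r + q * m)) → ∀ n → n % m ≡ r → P n
residue-elim P m r p n h = subst P (sym (trans (m≡m%n+[m/n]*n n m) (cong (_+ n / m * m) h))) (p (n / m))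

%2≡1⇒2∣∸1 : ∀ m → m % 2 ≡ 1 → 2 ∣ m ∸ 1
%2≡1⇒2∣∸1 m h = divides (m / 2) (cong (_∸ 1) (trans (m≡m%n+[m/n]*n m 2) (cong (_+ m / 2 * 2) h)))

∣b*b+1∧∣b∸1⇒∣2 : ∀ {d} b → d ∣ b * b + 1 → d ∣ b ∸ 1 → d ∣ 2
∣b*b+1∧∣b∸1⇒∣2 zero d∣1 _ = ∣-trans d∣1 (1∣ 2)
∣b*b+1∧∣b∸1⇒∣2 {d} (suc a) d∣b²+1 d∣a = ∣m+n∣m⇒∣n (subst (d ∣_) (expand a) d∣b²+1) (∣m⇒∣m*n (a + 2) d∣a)
  where
  expand : ∀ a → suc a * suc a + 1 ≡ a * (a + 2) + 2
  expand = solve-∀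

fibGcd : ℕ → ℕ
fibGcd n = gcd (fib n) (fib (suc n) ∸ 1)

fibGcd-double-even : ∀ m → m % 2 ≡ 0 → fibGcd (m * 2) ≡ fib m
fibGcd-double-even m h = begin
  gcd (fib (m * 2)) (fib (suc (m * 2)) ∸ 1)              ≡⟨ cong₂ gcd (fib-double m) (cong (_∸ 1) (fib-suc-double-even m h)) ⟩
  gcd (fib m * lucas m) (fib m * lucas (suc m) + 1 ∸ 1)  ≡⟨ cong (gcd (fib m * lucas m)) (m+n∸n≡m _ 1) ⟩
  gcd (fib m * lucas m) (fib m * lucas (suc m))          ≡⟨ gcd[cm,cn]≡c (fib m) (lucas-coprime-suc m) ⟩
  fib m                                                  ∎

fibGcd-double-odd : ∀ m → m % 2 ≡ 0 → fibGcd (suc m * 2) ≡ lucas (suc m)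
fibGcd-double-odd m h = begin
  gcd (fib (suc m * 2)) (fib (suc (suc m * 2)) ∸ 1)      ≡⟨ cong₂ gcd (trans (fib-double (suc m)) (*-comm (fib (suc m)) (lucas (suc m))))
                                                                      (cong (_∸ 1) (fib-suc-double-odd m h)) ⟩
  gcd (lucas (suc m) * fib (suc m)) (lucas (suc m) * fib (suc (suc m)) + 1 ∸ 1)
                                                         ≡⟨ cong (gcd (lucas (suc m) * fib (suc m))) (m+n∸n≡m _ 1) ⟩
  gcd (lucas (suc m) * fib (suc m)) (lucas (suc m) * fib (suc (suc m)))
                                                         ≡⟨ gcd[cm,cn]≡c (lucas (suc m)) (fib-coprime-suc (suc m)) ⟩
  lucas (suc m)                                          ∎

fibGcd-odd∣2 : ∀ n → n % 2 ≡ 1 → fibGcd n ∣ 2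
fibGcd-odd∣2 n h = ∣b*b+1∧∣b∸1⇒∣2 (fib (suc n))
  (subst (fibGcd n ∣_) (sym (cassini-odd n h)) (∣n⇒∣m*n (fib (suc (suc n))) (gcd[m,n]∣m (fib n) (fib (suc n) ∸ 1))))
  (gcd[m,n]∣n (fib n) (fib (suc n) ∸ 1))

fibGcd-odd≡1 : ∀ n → n % 2 ≡ 1 → fib n % 2 ≡ 1 → fibGcd n ≡ 1
fibGcd-odd≡1 n n%2≡1 fib[n]%2≡1 = ∣1⇒≡1 (subst (fibGcd n ∣_) fib[n]%2≡1
  (%-presˡ-∣ (gcd[m,n]∣m (fib n) (fib (suc n) ∸ 1)) (fibGcd-odd∣2 n n%2≡1)))

fibGcd-odd≡2 : ∀ n → n % 2 ≡ 1 → fib n % 2 ≡ 0 → fib (suc n) % 2 ≡ 1 → fibGcd n ≡ 2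
fibGcd-odd≡2 n n%2≡1 fib[n]%2≡0 fib[1+n]%2≡1 = ∣-antisym (fibGcd-odd∣2 n n%2≡1)
  (gcd-greatest (m%n≡0⇒n∣m (fib n) 2 fib[n]%2≡0) (%2≡1⇒2∣∸1 (fib (suc n)) fib[1+n]%2≡1))

fibGcd-%6≡3 : ∀ n → n % 6 ≡ 3 → fibGcd n ≡ 2
fibGcd-%6≡3 n h = fibGcd-odd≡2 n (%-reduce 2 n (divides 3 refl) h)
  (fib-%2 n (%-reduce 3 n (divides 2 refl) h))
  (fib-%2 (suc n) (%-reduce 3 (suc n) (divides 2 refl) (%-cong-suc {n} {3} 6 h)))

fibGcd-%6≡±1 : ∀ n → n % 6 ≡ 1 ⊎ n % 6 ≡ 5 → fibGcd n ≡ 1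
fibGcd-%6≡±1 n (inj₁ h) = fibGcd-odd≡1 n (%-reduce 2 n (divides 3 refl) h) (fib-%2 n (%-reduce 3 n (divides 2 refl) h))
fibGcd-%6≡±1 n (inj₂ h) = fibGcd-odd≡1 n (%-reduce 2 n (divides 3 refl) h) (fib-%2 n (%-reduce 3 n (divides 2 refl) h))

fibGcd-%4≡0 : ∀ n → n % 4 ≡ 0 → fibGcd n ≡ fib (n / 2)
fibGcd-%4≡0 = residue-elim (λ n → fibGcd n ≡ fib (n / 2)) 4 0 multipleOf4
  where
  multipleOf4 : ∀ k → fibGcd (k * 4) ≡ fib (k * 4 / 2)
  multipleOf4 k = begin
    fibGcd (k * 4)          ≡⟨ cong fibGcd (*-assoc k 2 2) ⟨
    fibGcd (k * 2 * 2)      ≡⟨ fibGcd-double-even (k * 2) (m*n%n≡0 k 2) ⟩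
    fib (k * 2)             ≡⟨ cong fib (m*n/n≡m (k * 2) 2) ⟨
    fib (k * 2 * 2 / 2)     ≡⟨ cong (λ m → fib (m / 2)) (*-assoc k 2 2) ⟩
    fib (k * 4 / 2)         ∎

fibGcd-%4≡2 : ∀ n → n % 4 ≡ 2 → fibGcd n ≡ fib (n / 2) + 2 * fib (n / 2 ∸ 1)
fibGcd-%4≡2 = residue-elim (λ n → fibGcd n ≡ fib (n / 2) + 2 * fib (n / 2 ∸ 1)) 4 2 twiceOdd
  where
  twiceOdd : ∀ k → fibGcd (2 + k * 4) ≡ fib ((2 + k * 4) / 2) + 2 * fib ((2 + k * 4) / 2 ∸ 1)
  twiceOdd k = begin
    fibGcd (2 + k * 4)                     ≡⟨ cong fibGcd shape ⟩
    fibGcd (suc (k * 2) * 2)               ≡⟨ fibGcd-double-odd (k * 2) (m*n%n≡0 k 2) ⟩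
    lucas (suc (k * 2))                    ≡⟨ lucas-suc (k * 2) ⟩
    fib (2 + k * 2) + fib (k * 2)          ≡⟨ regroup (fib (suc (k * 2))) (fib (k * 2)) ⟩
    fib (suc (k * 2)) + 2 * fib (k * 2)    ≡⟨ cong (λ h → fib h + 2 * fib (h ∸ 1)) half ⟨
    fib ((2 + k * 4) / 2) + 2 * fib ((2 + k * 4) / 2 ∸ 1) ∎
    where
    shape : 2 + k * 4 ≡ suc (k * 2) * 2
    shape = cong (2 +_) (sym (*-assoc k 2 2))
    half : (2 + k * 4) / 2 ≡ suc (k * 2)
    half = trans (cong (_/ 2) shape) (m*n/n≡m (suc (k * 2)) 2)
    regroup : ∀ a b → (a + b) + b ≡ a + 2 * b
    regroup = solve-∀

mainTheorem5 : (n : ℕ) → n ≥ 1 →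
    ((n % 6 ≡ 3 → gcd (fib n) (fib (n + 1) ∸ 1) ≡ 2)
    × ((n % 6 ≡ 1 ⊎ n % 6 ≡ 5) → gcd (fib n) (fib (n + 1) ∸ 1) ≡ 1)
    × (n % 4 ≡ 0 → gcd (fib n) (fib (n + 1) ∸ 1) ≡ fib (n / 2))
    × (n % 4 ≡ 2 → gcd (fib n) (fib (n + 1) ∸ 1) ≡ fib (n / 2) + 2 * fib (n / 2 ∸ 1)))
mainTheorem5 n _ rewrite +-comm n 1 = fibGcd-%6≡3 n , fibGcd-%6≡±1 n , fibGcd-%4≡0 n , fibGcd-%4≡2 n
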